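{- Let $l\geq 1$ and $\ell\geq 0$, let $n_1,\ldots,n_l\geq 1$ and $m_1,\ldots,m_\ell\geq 1$ be integers, and let $u_1,\ldots,u_l,v_1,\ldots,v_\ell\in\mathbb{Q}^+$. Let $n=[n_1,\ldots,n_l]$ be the least common multiple of the $n_i$, fix integers $c_1,\ldots,c_l$ with $\sum_{i=1}^l c_i\cdot n/n_i=1$, and put $x_0=\prod_{i=1}^{l}u_i^{ -c_i\cdot n/n_i}$. Then the system of conditions $R_{n_j}(u_j\cdot x)$ for $j=1,\ldots,l$ and $\neg R_{m_k}(v_k\cdot x)$ for $k=1,\ldots,\ell$ has a solution $x\in\mathbb{Q}^+$ if and only if $$\bigwedge_{i\neq j}R_{(n_i,n_j)}(u_i\cdot u_j^{ -1})\ \wedge\ \bigwedge_{k:\ m_k\mid n}\neg R_{m_k}(v_k\cdot x_0)$$ holds, where $(n_i,n_j)$ denotes the greatest common divisor of $n_i$ and $n_j$.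
   Context: $\mathbb{Q}^+=\{r\in\mathbb{Q}: r>0\}$. For an integer $d\geq 1$ and $x\in\mathbb{Q}^+$, $R_d(x)$ means that $x$ is the $d$-th power of a rational number, i.e. $\exists y\,[x=y^d]$. Integers $c_i$ as in the statement exist since $\gcd(n/n_1,\ldots,n/n_l)=1$. -}

module Defs where

open import Data.Nat as ℕ using (ℕ; zero; suc)
open import Data.Nat.LCM using (lcm)
open import Data.Integer as ℤ using (ℤ; +_; -[1+_])
open import Data.Fin using (Fin; zero; suc)
open import Data.Rational using (ℚ; 0ℚ; 1ℚ; _*_; 1/_; ≢-nonZero)
open import Data.Rational.Properties using (_≟_)
open import Data.Product using (∃)
open import Relation.Nullary using (yes; no)
open import Relation.Binary.PropositionalEquality using (_≡_)

_^ℕ_ : ℚ → ℕ → ℚ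
q ^ℕ zero  = 1ℚ
q ^ℕ suc k = q * (q ^ℕ k)

-- multiplicative inverse, made total by sending 0 to 0
-- (only ever applied to positive rationals in the statement)
inv : ℚ → ℚ
inv q with q ≟ 0ℚ
... | yes _  = 0ℚ
... | no q≢0 = 1/_ q {{≢-nonZero q≢0}}

_^ℤ_ : ℚ → ℤ → ℚ
q ^ℤ (+ k)     = q ^ℕ k
q ^ℤ -[1+ k ]  = inv (q ^ℕ suc k)

R : ℕ → ℚ → Set
R d x = ∃ λ (y : ℚ) → y ^ℕ d ≡ x

lcmF : (l : ℕ) → (Fin l → ℕ) → ℕ
lcmF zero    f = 1
lcmF (suc l) f = lcm (f zero) (lcmF l (λ i → f (suc i)))

sumℤ : (l : ℕ) → (Fin l → ℤ) → ℤ
sumℤ zero    f = + 0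
sumℤ (suc l) f = f zero ℤ.+ sumℤ l (λ i → f (suc i))

prodℚ : (l : ℕ) → (Fin l → ℚ) → ℚ
prodℚ zero    f = 1ℚ
prodℚ (suc l) f = f zero * prodℚ l (λ i → f (suc i))

-- Each R d is a subgroup of ℚ*. If x satisfies all R (n j) (u j x), then since Σ c i n / n i = 1,
--   x = x₀ · ∏ (u i x) ^ (c i n / n i),
-- and each factor is an n-th power; so x ∈ x₀ · R n. This gives the gcd conditions (u i / u j is a
-- quotient of an n i-th and an n j-th power) and, when m k ∣ n, turns ¬ R (m k) (v k x) into
-- ¬ R (m k) (v k x₀). Conversely, the gcd conditions make every u j x₀ an n j-th power, and
-- x = x₀ pⁿ works for a prime p dividing no numerator or denominator of the v k x₀: if m k ∣ n then
-- pⁿ is an m k-th power, and otherwise v k x₀ pⁿ has p-adic valuation n, which m k does not divide.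

module Submission where

open import Defs

module Primes where

  open import Data.Nat as ℕ using (ℕ; zero; suc; _+_; _*_; _^_; _∸_; _<_; NonZero)
  open import Data.Nat.Properties
  open import Data.Nat.Divisibility using (_∣_; _∤_; divides; _∣?_; ∣1⇒≡1; ∣-trans; ∣m+n∣m⇒∣n)
  open import Data.Nat.Induction using (<-wellFounded)
  open import Data.Nat.Primality using (Prime; euclidsLemma; prime⇒nonZero; prime⇒nonTrivial)
  open import Data.Nat.Primality.Factorisation using (factorise)
  open import Data.Nat.Solver using (module +-*-Solver)
  open import Data.List using ([]; _∷_; tabulate)
  open import Data.List.Relation.Unary.All using (_∷_)
  open import Data.Nat.ListAction using (product)
  open import Data.Nat.ListAction.Properties using (∈⇒∣product; product≢0)
  open import Data.List.Membership.Propositional.Properties using (∈-tabulate⁺)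
  open import Data.List.Relation.Unary.All.Properties using (tabulate⁺)
  open import Data.Fin using (Fin)
  open import Induction.WellFounded using (Acc; acc)
  open import Data.Product using (∃; _×_; _,_)
  open import Data.Sum using (inj₁; inj₂)
  open import Data.Empty using (⊥-elim)
  open import Relation.Nullary using (yes; no)
  open import Relation.Binary.PropositionalEquality

  ^-distribʳ-* : ∀ m n o → (m * n) ^ o ≡ m ^ o * n ^ o
  ^-distribʳ-* m n zero    = refl
  ^-distribʳ-* m n (suc o) rewrite ^-distribʳ-* m n o =
    solve 4 (λ m n a b → m :* n :* (a :* b) := m :* a :* (n :* b)) refl m n (m ^ o) (n ^ o)
    where open +-*-Solver

  ∃-prime-∤ : ∀ ℓ (f : Fin ℓ → ℕ) → (∀ k → NonZero (f k)) → ∃ λ p → Prime p × ∀ k → p ∤ f k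
  ∃-prime-∤ ℓ f f≢0 with factorise (suc M)
    where M = product (tabulate f)
  ... | record { factors = [] ; isFactorisation = 1+M≡1 } =
    ⊥-elim (ℕ.≢-nonZero⁻¹ _ {{product≢0 (tabulate⁺ f≢0)}} (suc-injective 1+M≡1))
  ... | record { factors = p ∷ ps ; isFactorisation = 1+M≡p*ps ; factorsPrime = p-prime ∷ _ } =
    p , p-prime , λ k p∣fk → p∤M (∣-trans p∣fk (∈⇒∣product (∈-tabulate⁺ k)))
    where
    M = product (tabulate f)
    p∣M+1 : p ∣ M + 1
    p∣M+1 = divides (product ps) (trans (+-comm M 1) (trans 1+M≡p*ps (*-comm p (product ps))))
    p∤M : p ∤ M
    p∤M p∣M = ℕ.nonTrivial⇒≢1 {{prime⇒nonTrivial p-prime}} (∣1⇒≡1 (∣m+n∣m⇒∣n p∣M+1 p∣M))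

  module _ {p : ℕ} (p-prime : Prime p) where

    private instance
      p≢0 : NonZero p
      p≢0 = prime⇒nonZero p-prime

    ∤-* : ∀ {x y} → p ∤ x → p ∤ y → p ∤ x * y
    ∤-* {x} {y} p∤x p∤y p∣xy with euclidsLemma x y p-prime p∣xy
    ... | inj₁ p∣x = p∤x p∣x
    ... | inj₂ p∣y = p∤y p∣y

    ∤-^ : ∀ {x} m → p ∤ x → p ∤ x ^ m
    ∤-^ zero    p∤x p∣1 = ℕ.nonTrivial⇒≢1 {{prime⇒nonTrivial p-prime}} (∣1⇒≡1 p∣1)
    ∤-^ (suc m) p∤x = ∤-* p∤x (∤-^ m p∤x)

    p^i*x≡p^j*y⇒i≡j : ∀ i j {x y} → p ∤ x → p ∤ y → p ^ i * x ≡ p ^ j * y → i ≡ j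
    p^i*x≡p^j*y⇒i≡j zero    zero    p∤x p∤y eq = refl
    p^i*x≡p^j*y⇒i≡j zero    (suc j) {x} {y} p∤x p∤y eq =
      ⊥-elim (p∤x (divides (p ^ j * y) (trans (sym (+-identityʳ x)) (trans eq (trans (*-assoc p _ y) (*-comm p _))))))
    p^i*x≡p^j*y⇒i≡j (suc i) zero    p∤x p∤y eq = sym (p^i*x≡p^j*y⇒i≡j zero (suc i) p∤y p∤x (sym eq))
    p^i*x≡p^j*y⇒i≡j (suc i) (suc j) {x} {y} p∤x p∤y eq = cong suc (p^i*x≡p^j*y⇒i≡j i j p∤x p∤y
      (*-cancelˡ-≡ _ _ p (trans (sym (*-assoc p (p ^ i) x)) (trans eq (*-assoc p (p ^ j) y)))))

    ∃-p-free-part : ∀ A → A ≢ 0 → ∃ λ α → ∃ λ A′ → A ≡ p ^ α * A′ × p ∤ A′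
    ∃-p-free-part A = go A (<-wellFounded A)
      where
      go : ∀ A → Acc _<_ A → A ≢ 0 → ∃ λ α → ∃ λ A′ → A ≡ p ^ α * A′ × p ∤ A′
      go A _ A≢0 with p ∣? A
      go A _ A≢0        | no  p∤A = 0 , A , sym (+-identityʳ A) , p∤A
      go A (acc rs) A≢0 | yes (divides q A≡q*p) with go q (rs q<A) q≢0
        where
        q≢0 : q ≢ 0
        q≢0 refl = A≢0 A≡q*p
        q<A : q < A
        q<A = subst (q <_) (sym A≡q*p)
          (m<m*n q p {{ℕ.≢-nonZero q≢0}} (ℕ.nonTrivial⇒n>1 p {{prime⇒nonTrivial p-prime}}))
      ... | α , A′ , q≡p^α*A′ , p∤A′ =
        suc α , A′ , trans A≡q*p (trans (*-comm q p) (trans (cong (p *_) q≡p^α*A′) (sym (*-assoc p (p ^ α) A′))))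
              , p∤A′

    A^m*D≡Q*p^N*B^m⇒m∣N : ∀ {A B D Q} m N → A ≢ 0 → B ≢ 0 → p ∤ D → p ∤ Q →
                           A ^ m * D ≡ Q * p ^ N * B ^ m → m ∣ N
    A^m*D≡Q*p^N*B^m⇒m∣N {A} {B} {D} {Q} m N A≢0 B≢0 p∤D p∤Q eq
      with ∃-p-free-part A A≢0 | ∃-p-free-part B B≢0
    ... | α , A′ , refl , p∤A′ | β , B′ , refl , p∤B′ = divides (α ∸ β) (begin
      N                      ≡⟨ sym (m+n∸n≡m N (β * m)) ⟩
      N + β * m ∸ β * m      ≡⟨ cong (_∸ β * m) (sym αm≡N+βm) ⟩
      α * m ∸ β * m          ≡⟨ sym (*-distribʳ-∸ m α β) ⟩
      (α ∸ β) * m            ∎)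
      where
      open ≡-Reasoning
      open +-*-Solver
      ^-split : ∀ γ C → (p ^ γ * C) ^ m ≡ p ^ (γ * m) * C ^ m
      ^-split γ C = trans (^-distribʳ-* (p ^ γ) C m) (cong (_* C ^ m) (^-*-assoc p γ m))
      αm≡N+βm : α * m ≡ N + β * m
      αm≡N+βm = p^i*x≡p^j*y⇒i≡j (α * m) (N + β * m) (∤-* (∤-^ m p∤A′) p∤D) (∤-* p∤Q (∤-^ m p∤B′))
        (begin
        p ^ (α * m) * (A′ ^ m * D)         ≡⟨ sym (*-assoc (p ^ (α * m)) _ D) ⟩
        p ^ (α * m) * A′ ^ m * D           ≡⟨ cong (_* D) (sym (^-split α A′)) ⟩
        (p ^ α * A′) ^ m * D               ≡⟨ eq ⟩
        Q * p ^ N * (p ^ β * B′) ^ m       ≡⟨ cong (Q * p ^ N *_) (^-split β B′) ⟩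
        Q * p ^ N * (p ^ (β * m) * B′ ^ m) ≡⟨ solve 4 (λ q a b c → q :* a :* (b :* c) := a :* b :* (q :* c))
                                                      refl Q (p ^ N) _ _ ⟩
        p ^ N * p ^ (β * m) * (Q * B′ ^ m) ≡⟨ cong (_* (Q * B′ ^ m)) (sym (^-distribˡ-+-* p N (β * m))) ⟩
        p ^ (N + β * m) * (Q * B′ ^ m)     ∎)

open Primes

open import Data.Nat as ℕ using (ℕ; zero; suc; NonZero; _≤_; _/_)
import Data.Nat.Properties as ℕ
open import Data.Nat.Divisibility using (_∣_; _∤_; divides; _∣0; _∣?_; ∣-refl; ∣-trans; m∣m*n; n∣m*n)
open import Data.Nat.Coprimality using (1-coprimeTo)
import Data.Nat.Coprimality as Coprime
open import Data.Nat.GCD using (gcd; gcd[m,n]∣m; gcd[m,n]∣n)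
open import Data.Nat.LCM using (lcm; m∣lcm[m,n]; n∣lcm[m,n]; lcm-least; gcd*lcm)
open import Data.Nat.DivMod using (m*[n/m]≡n)
open import Data.Nat.Primality using (Prime; prime⇒nonZero)
open import Data.Nat.Solver using (module +-*-Solver)
open import Data.Integer as ℤ using (ℤ; +_; -[1+_]; +[1+_]; -_; _⊖_)
import Data.Integer.Properties as ℤ
import Data.Integer.Solver as ℤ-Solver
open import Data.Rational using (ℚ; 0ℚ; 1ℚ; _*_; Positive; mkℚ; mkℚ+; ↥_; ↧_; ↧ₙ_; ≢-nonZero)
import Data.Rational.Properties as ℚ
open import Data.Rational.Properties
  using (_≟_; *-assoc; *-comm; *-identityˡ; *-identityʳ; *-zeroˡ; *-zeroʳ; *-inverseʳ; 1/pos⇒pos; pos*pos⇒pos)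
import Data.Rational.Unnormalised as ℚᵘ
open import Algebra.Bundles using (CommutativeMonoid)
open import Algebra.Properties.CommutativeSemigroup
  (CommutativeMonoid.commutativeSemigroup ℚ.*-1-commutativeMonoid) using (interchange)
open import Data.Fin using (Fin; zero; suc)
import Data.Fin.Properties as Fin
open import Data.Product using (∃; _×_; _,_; proj₁; proj₂)
open import Data.Empty using (⊥-elim)
open import Relation.Nullary using (¬_; Dec; yes; no)
open import Relation.Binary.PropositionalEquality
open import Function.Bundles using (_⇔_; mk⇔)

pos⇒≢0 : ∀ {q} → Positive q → q ≢ 0ℚ
pos⇒≢0 {mkℚ +[1+ _ ] _ _} _ ()

*-pos : ∀ p q → Positive p → Positive q → Positive (p * q)
*-pos p q p>0 q>0 = pos*pos⇒pos p {{p>0}} q {{q>0}}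

inv-inverseʳ : ∀ {q} → q ≢ 0ℚ → q * inv q ≡ 1ℚ
inv-inverseʳ {q} q≢0 with q ≟ 0ℚ
... | yes q≡0 = ⊥-elim (q≢0 q≡0)
... | no  q≢0 = *-inverseʳ q {{≢-nonZero q≢0}}

inv-inverseˡ : ∀ {q} → q ≢ 0ℚ → inv q * q ≡ 1ℚ
inv-inverseˡ {q} q≢0 = trans (*-comm (inv q) q) (inv-inverseʳ q≢0)

inv-pos : ∀ q → Positive q → Positive (inv q)
inv-pos q q>0 with q ≟ 0ℚ
... | yes q≡0 = ⊥-elim (pos⇒≢0 q>0 q≡0)
... | no  q≢0 = 1/pos⇒pos q {{q>0}}

*≡1⇒inv≡ : ∀ a b → a * b ≡ 1ℚ → inv a ≡ b
*≡1⇒inv≡ a b ab≡1 = begin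
  inv a            ≡⟨ sym (*-identityʳ (inv a)) ⟩
  inv a * 1ℚ       ≡⟨ cong (inv a *_) (sym ab≡1) ⟩
  inv a * (a * b)  ≡⟨ sym (*-assoc (inv a) a b) ⟩
  (inv a * a) * b  ≡⟨ cong (_* b) (inv-inverseˡ a≢0) ⟩
  1ℚ * b           ≡⟨ *-identityˡ b ⟩
  b                ∎
  where
  open ≡-Reasoning
  1≢0 : 1ℚ ≢ 0ℚ
  1≢0 ()
  a≢0 : a ≢ 0ℚ
  a≢0 a≡0 = 1≢0 (trans (sym ab≡1) (trans (cong (_* b) a≡0) (*-zeroˡ b)))

-- Since inv 0 = 0, inv commutes with products and powers without side conditions.
inv-* : ∀ a b → inv (a * b) ≡ inv a * inv b
inv-* a b = by-cases (a ≟ 0ℚ) (b ≟ 0ℚ)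
  where
  open ≡-Reasoning
  by-cases : Dec (a ≡ 0ℚ) → Dec (b ≡ 0ℚ) → inv (a * b) ≡ inv a * inv b
  by-cases (yes refl) _ = trans (cong inv (*-zeroˡ b)) (sym (*-zeroˡ (inv b)))
  by-cases (no _) (yes refl) = trans (cong inv (*-zeroʳ a)) (sym (*-zeroʳ (inv a)))
  by-cases (no a≢0) (no b≢0) = *≡1⇒inv≡ (a * b) (inv a * inv b) (begin
    (a * b) * (inv a * inv b)  ≡⟨ interchange a b (inv a) (inv b) ⟩
    (a * inv a) * (b * inv b)  ≡⟨ cong₂ _*_ (inv-inverseʳ a≢0) (inv-inverseʳ b≢0) ⟩
    1ℚ                         ∎)

inv-involutive : ∀ q → inv (inv q) ≡ q
inv-involutive q = by-cases (q ≟ 0ℚ)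
  where
  by-cases : Dec (q ≡ 0ℚ) → inv (inv q) ≡ q
  by-cases (yes refl) = refl
  by-cases (no q≢0) = *≡1⇒inv≡ (inv q) q (inv-inverseˡ q≢0)

^ℕ-distribˡ-+-* : ∀ q a b → q ^ℕ (a ℕ.+ b) ≡ q ^ℕ a * q ^ℕ b
^ℕ-distribˡ-+-* q zero    b = sym (*-identityˡ _)
^ℕ-distribˡ-+-* q (suc a) b = trans (cong (q *_) (^ℕ-distribˡ-+-* q a b)) (sym (*-assoc q _ _))

^ℕ-distribʳ-* : ∀ p q n → (p * q) ^ℕ n ≡ p ^ℕ n * q ^ℕ n
^ℕ-distribʳ-* p q zero    = refl
^ℕ-distribʳ-* p q (suc n) = trans (cong ((p * q) *_) (^ℕ-distribʳ-* p q n)) (interchange p q _ _)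

1^ℕ≡1 : ∀ n → 1ℚ ^ℕ n ≡ 1ℚ
1^ℕ≡1 zero    = refl
1^ℕ≡1 (suc n) = trans (*-identityˡ _) (1^ℕ≡1 n)

^ℕ-*-assoc : ∀ q a b → (q ^ℕ a) ^ℕ b ≡ q ^ℕ (a ℕ.* b)
^ℕ-*-assoc q zero    b = 1^ℕ≡1 b
^ℕ-*-assoc q (suc a) b = begin
  (q * q ^ℕ a) ^ℕ b             ≡⟨ ^ℕ-distribʳ-* q (q ^ℕ a) b ⟩
  q ^ℕ b * (q ^ℕ a) ^ℕ b        ≡⟨ cong (q ^ℕ b *_) (^ℕ-*-assoc q a b) ⟩
  q ^ℕ b * q ^ℕ (a ℕ.* b)       ≡⟨ sym (^ℕ-distribˡ-+-* q b (a ℕ.* b)) ⟩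
  q ^ℕ (b ℕ.+ a ℕ.* b)          ∎
  where open ≡-Reasoning

^ℕ-comm : ∀ q a b → (q ^ℕ a) ^ℕ b ≡ (q ^ℕ b) ^ℕ a
^ℕ-comm q a b = begin
  (q ^ℕ a) ^ℕ b    ≡⟨ ^ℕ-*-assoc q a b ⟩
  q ^ℕ (a ℕ.* b)   ≡⟨ cong (q ^ℕ_) (ℕ.*-comm a b) ⟩
  q ^ℕ (b ℕ.* a)   ≡⟨ sym (^ℕ-*-assoc q b a) ⟩
  (q ^ℕ b) ^ℕ a    ∎
  where open ≡-Reasoning

^ℕ-pos : ∀ q n → Positive q → Positive (q ^ℕ n)
^ℕ-pos q zero    q>0 = _
^ℕ-pos q (suc n) q>0 = *-pos q (q ^ℕ n) q>0 (^ℕ-pos q n q>0)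

inv-^ℕ : ∀ q n → inv (q ^ℕ n) ≡ inv q ^ℕ n
inv-^ℕ q zero    = refl
inv-^ℕ q (suc n) = trans (inv-* q (q ^ℕ n)) (cong (inv q *_) (inv-^ℕ q n))

^ℤ-⊖ : ∀ {q} → q ≢ 0ℚ → ∀ a b → q ^ℤ (a ⊖ b) ≡ q ^ℕ a * inv (q ^ℕ b)
^ℤ-⊖ q≢0 a       zero    = sym (*-identityʳ _)
^ℤ-⊖ q≢0 zero    (suc b) = sym (*-identityˡ _)
^ℤ-⊖ {q} q≢0 (suc a) (suc b) rewrite ℤ.[1+m]⊖[1+n]≡m⊖n a b = begin
  q ^ℤ (a ⊖ b)                              ≡⟨ ^ℤ-⊖ q≢0 a b ⟩
  q ^ℕ a * inv (q ^ℕ b)                     ≡⟨ sym (*-identityˡ _) ⟩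
  1ℚ * (q ^ℕ a * inv (q ^ℕ b))              ≡⟨ cong (_* (q ^ℕ a * inv (q ^ℕ b))) (sym (inv-inverseʳ q≢0)) ⟩
  (q * inv q) * (q ^ℕ a * inv (q ^ℕ b))     ≡⟨ interchange q (inv q) _ _ ⟩
  (q * q ^ℕ a) * (inv q * inv (q ^ℕ b))     ≡⟨ cong ((q * q ^ℕ a) *_) (sym (inv-* q (q ^ℕ b))) ⟩
  (q * q ^ℕ a) * inv (q * q ^ℕ b)           ∎
  where open ≡-Reasoning

⊖-+-⊖ : ∀ a b c d → (a ⊖ b) ℤ.+ (c ⊖ d) ≡ (a ℕ.+ c) ⊖ (b ℕ.+ d)
⊖-+-⊖ a b c d = begin
  (a ⊖ b) ℤ.+ (c ⊖ d)                       ≡⟨ sym (cong₂ ℤ._+_ (ℤ.m-n≡m⊖n a b) (ℤ.m-n≡m⊖n c d)) ⟩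
  (+ a ℤ.- + b) ℤ.+ (+ c ℤ.- + d)           ≡⟨ solve 4 (λ a b c d → (a :- b) :+ (c :- d) := (a :+ c) :- (b :+ d))
                                                 refl (+ a) (+ b) (+ c) (+ d) ⟩
  (+ a ℤ.+ + c) ℤ.- (+ b ℤ.+ + d)           ≡⟨ cong₂ ℤ._-_ (sym (ℤ.pos-+ a c)) (sym (ℤ.pos-+ b d)) ⟩
  + (a ℕ.+ c) ℤ.- + (b ℕ.+ d)               ≡⟨ ℤ.m-n≡m⊖n (a ℕ.+ c) (b ℕ.+ d) ⟩
  (a ℕ.+ c) ⊖ (b ℕ.+ d)                     ∎
  where
  open ≡-Reasoning
  open ℤ-Solver.+-*-Solver

^ℤ-distribˡ-+-* : ∀ {q} → q ≢ 0ℚ → ∀ j k → q ^ℤ (j ℤ.+ k) ≡ q ^ℤ j * q ^ℤ k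
^ℤ-distribˡ-+-* {q} q≢0 j k with as-difference j | as-difference k
  where
  as-difference : ∀ k → ∃ λ a → ∃ λ b → k ≡ a ⊖ b
  as-difference (+ a)    = a , 0 , refl
  as-difference -[1+ b ] = 0 , suc b , refl
... | a , b , refl | c , d , refl = begin
  q ^ℤ ((a ⊖ b) ℤ.+ (c ⊖ d))
    ≡⟨ cong (q ^ℤ_) (⊖-+-⊖ a b c d) ⟩
  q ^ℤ ((a ℕ.+ c) ⊖ (b ℕ.+ d))
    ≡⟨ ^ℤ-⊖ q≢0 (a ℕ.+ c) (b ℕ.+ d) ⟩
  q ^ℕ (a ℕ.+ c) * inv (q ^ℕ (b ℕ.+ d))
    ≡⟨ cong₂ (λ x y → x * inv y) (^ℕ-distribˡ-+-* q a c) (^ℕ-distribˡ-+-* q b d) ⟩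
  (q ^ℕ a * q ^ℕ c) * inv (q ^ℕ b * q ^ℕ d)
    ≡⟨ cong ((q ^ℕ a * q ^ℕ c) *_) (inv-* (q ^ℕ b) (q ^ℕ d)) ⟩
  (q ^ℕ a * q ^ℕ c) * (inv (q ^ℕ b) * inv (q ^ℕ d))
    ≡⟨ interchange (q ^ℕ a) (q ^ℕ c) _ _ ⟩
  (q ^ℕ a * inv (q ^ℕ b)) * (q ^ℕ c * inv (q ^ℕ d))
    ≡⟨ cong₂ _*_ (^ℤ-⊖ q≢0 a b) (^ℤ-⊖ q≢0 c d) ⟨
  q ^ℤ (a ⊖ b) * q ^ℤ (c ⊖ d)
    ∎
  where open ≡-Reasoning

^ℤ-distribʳ-* : ∀ p q k → (p * q) ^ℤ k ≡ p ^ℤ k * q ^ℤ k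
^ℤ-distribʳ-* p q (+ n)    = ^ℕ-distribʳ-* p q n
^ℤ-distribʳ-* p q -[1+ n ] = trans (cong inv (^ℕ-distribʳ-* p q (suc n))) (inv-* (p ^ℕ suc n) (q ^ℕ suc n))

^ℤ-neg : ∀ q k → q ^ℤ (- k) ≡ inv (q ^ℤ k)
^ℤ-neg q (+ zero)  = refl
^ℤ-neg q +[1+ n ]  = refl
^ℤ-neg q -[1+ n ]  = sym (inv-involutive (q ^ℕ suc n))

inv-^ℤ : ∀ q k → inv q ^ℤ k ≡ inv (q ^ℤ k)
inv-^ℤ q (+ n)    = sym (inv-^ℕ q n)
inv-^ℤ q -[1+ n ] = cong inv (sym (inv-^ℕ q (suc n)))

^ℤ-*-assoc : ∀ {q} → q ≢ 0ℚ → ∀ k n → (q ^ℤ k) ^ℕ n ≡ q ^ℤ (k ℤ.* + n)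
^ℤ-*-assoc {q} q≢0 k zero    = cong (q ^ℤ_) (sym (ℤ.*-zeroʳ k))
^ℤ-*-assoc {q} q≢0 k (suc n) = begin
  q ^ℤ k * (q ^ℤ k) ^ℕ n        ≡⟨ cong (q ^ℤ k *_) (^ℤ-*-assoc q≢0 k n) ⟩
  q ^ℤ k * q ^ℤ (k ℤ.* + n)     ≡⟨ sym (^ℤ-distribˡ-+-* q≢0 k (k ℤ.* + n)) ⟩
  q ^ℤ (k ℤ.+ k ℤ.* + n)        ≡⟨ cong (q ^ℤ_) (sym (ℤ.*-suc k (+ n))) ⟩
  q ^ℤ (k ℤ.* + suc n)          ∎
  where open ≡-Reasoning

^ℕ-^ℤ-comm : ∀ q n k → (q ^ℕ n) ^ℤ k ≡ (q ^ℤ k) ^ℕ n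
^ℕ-^ℤ-comm q n (+ a)    = ^ℕ-comm q n a
^ℕ-^ℤ-comm q n -[1+ a ] = trans (cong inv (^ℕ-comm q n (suc a))) (inv-^ℕ (q ^ℕ suc a) n)

^ℤ-pos : ∀ q k → Positive q → Positive (q ^ℤ k)
^ℤ-pos q (+ n)    q>0 = ^ℕ-pos q n q>0
^ℤ-pos q -[1+ n ] q>0 = inv-pos (q ^ℕ suc n) (^ℕ-pos q (suc n) q>0)

prodℚ-cong : ∀ l {f g : Fin l → ℚ} → (∀ i → f i ≡ g i) → prodℚ l f ≡ prodℚ l g
prodℚ-cong zero    f≗g = refl
prodℚ-cong (suc l) f≗g = cong₂ _*_ (f≗g zero) (prodℚ-cong l (λ i → f≗g (suc i)))

prodℚ-distrib-* : ∀ l (f g : Fin l → ℚ) → prodℚ l (λ i → f i * g i) ≡ prodℚ l f * prodℚ l g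
prodℚ-distrib-* zero    f g = refl
prodℚ-distrib-* (suc l) f g = trans
  (cong (f zero * g zero *_) (prodℚ-distrib-* l (λ i → f (suc i)) (λ i → g (suc i))))
  (interchange (f zero) (g zero) _ _)

prodℚ-^ℤ : ∀ {q} → q ≢ 0ℚ → ∀ l (k : Fin l → ℤ) → prodℚ l (λ i → q ^ℤ k i) ≡ q ^ℤ sumℤ l k
prodℚ-^ℤ q≢0 zero    k = refl
prodℚ-^ℤ {q} q≢0 (suc l) k = trans
  (cong (q ^ℤ k zero *_) (prodℚ-^ℤ q≢0 l (λ i → k (suc i))))
  (sym (^ℤ-distribˡ-+-* q≢0 (k zero) _))

prodℚ-pos : ∀ l (f : Fin l → ℚ) → (∀ i → Positive (f i)) → Positive (prodℚ l f)
prodℚ-pos zero    f f>0 = _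
prodℚ-pos (suc l) f f>0 = *-pos (f zero) _ (f>0 zero) (prodℚ-pos l (λ i → f (suc i)) (λ i → f>0 (suc i)))

R-1 : ∀ d → R d 1ℚ
R-1 d = 1ℚ , 1^ℕ≡1 d

R-* : ∀ d {a b} → R d a → R d b → R d (a * b)
R-* d (y , refl) (z , refl) = y * z , ^ℕ-distribʳ-* y z d

R-inv : ∀ d {a} → R d a → R d (inv a)
R-inv d (y , refl) = inv y , sym (inv-^ℕ y d)

R-^ℤ : ∀ d {a} k → R d a → R d (a ^ℤ k)
R-^ℤ d k (y , refl) = y ^ℤ k , sym (^ℕ-^ℤ-comm y d k)

R-^ℕ : ∀ d {a} e → R d a → R (d ℕ.* e) (a ^ℕ e)
R-^ℕ d e (y , refl) = y , sym (^ℕ-*-assoc y d e)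

R-∣ : ∀ {d e a} → d ∣ e → R e a → R d a
R-∣ {d} (divides q refl) (y , refl) = y ^ℕ q , ^ℕ-*-assoc y q d

R-prodℚ : ∀ d l (f : Fin l → ℚ) → (∀ i → R d (f i)) → R d (prodℚ l f)
R-prodℚ d zero    f Rf = R-1 d
R-prodℚ d (suc l) f Rf = R-* d (Rf zero) (R-prodℚ d l (λ i → f (suc i)) (λ i → Rf (suc i)))

-- q = ± a / b, as a cross-multiplied equation of naturals
record IsAbsRatio (q : ℚ) (a b : ℕ) : Set where
  constructor absRatio
  field cross-multiplied : ℤ.∣ ↥ q ∣ ℕ.* b ≡ a ℕ.* ↧ₙ q

isAbsRatio-self : ∀ q → IsAbsRatio q ℤ.∣ ↥ q ∣ (↧ₙ q)
isAbsRatio-self q = absRatio refl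

↥-*-cross : ∀ p q → ↥ (p * q) ℤ.* (↧ p ℤ.* ↧ q) ≡ (↥ p ℤ.* ↥ q) ℤ.* ↧ (p * q)
↥-*-cross p@(mkℚ _ _ _) q@(mkℚ _ _ _) with ℚ.toℚᵘ-homo-* p q
... | ℚᵘ.*≡* eq = subst₂ (λ a b → a ℤ.* (↧ p ℤ.* ↧ q) ≡ (↥ p ℤ.* ↥ q) ℤ.* b)
                        (ℚ.↥ᵘ-toℚᵘ (p * q)) (ℚ.↧ᵘ-toℚᵘ (p * q)) eq

∣↥∣-*-cross : ∀ p q →
              ℤ.∣ ↥ (p * q) ∣ ℕ.* (↧ₙ p ℕ.* ↧ₙ q) ≡ ℤ.∣ ↥ p ∣ ℕ.* ℤ.∣ ↥ q ∣ ℕ.* ↧ₙ (p * q)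
∣↥∣-*-cross p@(mkℚ _ _ _) q@(mkℚ _ _ _) = begin
  ℤ.∣ ↥ (p * q) ∣ ℕ.* ℤ.∣ ↧ p ℤ.* ↧ q ∣    ≡⟨ ℤ.abs-* (↥ (p * q)) (↧ p ℤ.* ↧ q) ⟨
  ℤ.∣ ↥ (p * q) ℤ.* (↧ p ℤ.* ↧ q) ∣        ≡⟨ cong ℤ.∣_∣ (↥-*-cross p q) ⟩
  ℤ.∣ (↥ p ℤ.* ↥ q) ℤ.* ↧ (p * q) ∣        ≡⟨ ℤ.abs-* (↥ p ℤ.* ↥ q) (↧ (p * q)) ⟩
  ℤ.∣ ↥ p ℤ.* ↥ q ∣ ℕ.* ↧ₙ (p * q)         ≡⟨ cong (ℕ._* ↧ₙ (p * q)) (ℤ.abs-* (↥ p) (↥ q)) ⟩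
  ℤ.∣ ↥ p ∣ ℕ.* ℤ.∣ ↥ q ∣ ℕ.* ↧ₙ (p * q)   ∎
  where open ≡-Reasoning

isAbsRatio-* : ∀ p q {a b c d} → IsAbsRatio p a b → IsAbsRatio q c d →
               IsAbsRatio (p * q) (a ℕ.* c) (b ℕ.* d)
isAbsRatio-* p@(mkℚ _ _ _) q@(mkℚ _ _ _) {a} {b} {c} {d} (absRatio p≐a/b) (absRatio q≐c/d) =
  absRatio (ℕ.*-cancelʳ-≡ (M ℕ.* (b ℕ.* d)) (a ℕ.* c ℕ.* D) (P ℕ.* Q) (begin
    M ℕ.* (b ℕ.* d) ℕ.* (P ℕ.* Q)      ≡⟨ solve 5 (λ M b d P Q → M :* (b :* d) :* (P :* Q) := M :* (P :* Q) :* (b :* d))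
                                            refl M b d P Q ⟩
    M ℕ.* (P ℕ.* Q) ℕ.* (b ℕ.* d)      ≡⟨ cong (ℕ._* (b ℕ.* d)) (∣↥∣-*-cross p q) ⟩
    X ℕ.* Y ℕ.* D ℕ.* (b ℕ.* d)        ≡⟨ solve 5 (λ X Y D b d → X :* Y :* D :* (b :* d) := (X :* b) :* (Y :* d) :* D)
                                            refl X Y D b d ⟩
    (X ℕ.* b) ℕ.* (Y ℕ.* d) ℕ.* D      ≡⟨ cong₂ (λ s t → s ℕ.* t ℕ.* D) p≐a/b q≐c/d ⟩
    (a ℕ.* P) ℕ.* (c ℕ.* Q) ℕ.* D      ≡⟨ solve 5 (λ a P c Q D → (a :* P) :* (c :* Q) :* D := a :* c :* D :* (P :* Q))
                                            refl a P c Q D ⟩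
    a ℕ.* c ℕ.* D ℕ.* (P ℕ.* Q)        ∎))
  where
  open ≡-Reasoning
  open +-*-Solver
  M = ℤ.∣ ↥ (p * q) ∣
  D = ↧ₙ (p * q)
  X = ℤ.∣ ↥ p ∣
  Y = ℤ.∣ ↥ q ∣
  P = ↧ₙ p
  Q = ↧ₙ q

isAbsRatio-^ℕ : ∀ q {a b} m → IsAbsRatio q a b → IsAbsRatio (q ^ℕ m) (a ℕ.^ m) (b ℕ.^ m)
isAbsRatio-^ℕ q zero    q≐a/b = absRatio refl
isAbsRatio-^ℕ q (suc m) q≐a/b = isAbsRatio-* q (q ^ℕ m) q≐a/b (isAbsRatio-^ℕ q m q≐a/b)

isAbsRatio-unique : ∀ r {a b c d} → IsAbsRatio r a b → IsAbsRatio r c d → a ℕ.* d ≡ c ℕ.* b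
isAbsRatio-unique r@(mkℚ _ _ _) {a} {b} {c} {d} (absRatio r≐a/b) (absRatio r≐c/d) =
  ℕ.*-cancelʳ-≡ (a ℕ.* d) (c ℕ.* b) D (begin
    a ℕ.* d ℕ.* D      ≡⟨ solve 3 (λ a d D → a :* d :* D := a :* D :* d) refl a d D ⟩
    a ℕ.* D ℕ.* d      ≡⟨ cong (ℕ._* d) r≐a/b ⟨
    M ℕ.* b ℕ.* d      ≡⟨ solve 3 (λ M b d → M :* b :* d := M :* d :* b) refl M b d ⟩
    M ℕ.* d ℕ.* b      ≡⟨ cong (ℕ._* b) r≐c/d ⟩
    c ℕ.* D ℕ.* b      ≡⟨ solve 3 (λ c D b → c :* D :* b := c :* b :* D) refl c D b ⟩
    c ℕ.* b ℕ.* D      ∎)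
  where
  open ≡-Reasoning
  open +-*-Solver
  M = ℤ.∣ ↥ r ∣
  D = ↧ₙ r

fromℕ : ℕ → ℚ
fromℕ p = mkℚ+ p 1 (Coprime.sym (1-coprimeTo p))

fromℕ-pos : ∀ p .{{_ : NonZero p}} → Positive (fromℕ p)
fromℕ-pos (suc p) = _

-- Write y = ± A / B and q = ± Q / D; then y ^ m = q p ^ N reads A ^ m D = Q p ^ N B ^ m.
¬R[q*p^N] : ∀ {p} → Prime p → ∀ q → p ∤ ℤ.∣ ↥ q ∣ → p ∤ ↧ₙ q →
            ∀ m N → .{{NonZero m}} → m ∤ N → ¬ R m (q * fromℕ p ^ℕ N)
¬R[q*p^N] {p} p-prime q p∤Q p∤D m@(suc _) N m∤N (y , y^m≡q*p^N) =
  m∤N (A^m*D≡Q*p^N*B^m⇒m∣N p-prime m N A≢0 (λ ()) p∤D p∤Q A^m*D≡Q*p^N*B^m)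
  where
  A = ℤ.∣ ↥ y ∣
  B = ↧ₙ y
  Q = ℤ.∣ ↥ q ∣
  D = ↧ₙ q
  y^m≐A^m/B^m : IsAbsRatio (q * fromℕ p ^ℕ N) (A ℕ.^ m) (B ℕ.^ m)
  y^m≐A^m/B^m = subst (λ r → IsAbsRatio r (A ℕ.^ m) (B ℕ.^ m)) y^m≡q*p^N (isAbsRatio-^ℕ y m (isAbsRatio-self y))
  q*p^N≐Q*p^N/D*1^N : IsAbsRatio (q * fromℕ p ^ℕ N) (Q ℕ.* p ℕ.^ N) (D ℕ.* 1 ℕ.^ N)
  q*p^N≐Q*p^N/D*1^N = isAbsRatio-* q (fromℕ p ^ℕ N) (isAbsRatio-self q) (isAbsRatio-^ℕ (fromℕ p) N (absRatio refl))
  A^m*D≡Q*p^N*B^m : A ℕ.^ m ℕ.* D ≡ Q ℕ.* p ℕ.^ N ℕ.* B ℕ.^ m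
  A^m*D≡Q*p^N*B^m = begin
    A ℕ.^ m ℕ.* D                 ≡⟨ cong (A ℕ.^ m ℕ.*_) (ℕ.*-identityʳ D) ⟨
    A ℕ.^ m ℕ.* (D ℕ.* 1)         ≡⟨ cong (λ z → A ℕ.^ m ℕ.* (D ℕ.* z)) (ℕ.^-zeroˡ N) ⟨
    A ℕ.^ m ℕ.* (D ℕ.* 1 ℕ.^ N)   ≡⟨ isAbsRatio-unique (q * fromℕ p ^ℕ N) y^m≐A^m/B^m q*p^N≐Q*p^N/D*1^N ⟩
    Q ℕ.* p ℕ.^ N ℕ.* B ℕ.^ m     ∎
    where open ≡-Reasoning
  Q≢0 : NonZero Q
  Q≢0 = ℕ.≢-nonZero (λ Q≡0 → p∤Q (subst (p ∣_) (sym Q≡0) (p ∣0)))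
  Q*p^N*B^m≢0 : NonZero (Q ℕ.* p ℕ.^ N ℕ.* B ℕ.^ m)
  Q*p^N*B^m≢0 =
    ℕ.m*n≢0 _ _ {{ℕ.m*n≢0 Q _ {{Q≢0}} {{ℕ.m^n≢0 p N {{prime⇒nonZero p-prime}}}}}} {{ℕ.m^n≢0 B m}}
  A≢0 : A ≢ 0
  A≢0 A≡0 = ℕ.≢-nonZero⁻¹ _ {{Q*p^N*B^m≢0}}
    (trans (sym A^m*D≡Q*p^N*B^m) (cong (λ a → a ℕ.^ m ℕ.* D) A≡0))

∃-prime-∤-↥↧ : ∀ ℓ (q : Fin ℓ → ℚ) → (∀ k → Positive (q k)) →
               ∃ λ p → Prime p × ∀ k → p ∤ ℤ.∣ ↥ q k ∣ × p ∤ ↧ₙ q k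
∃-prime-∤-↥↧ ℓ q q>0 with ∃-prime-∤ ℓ (λ k → ℤ.∣ ↥ q k ∣ ℕ.* ↧ₙ q k) (λ k → ↥↧≢0 (q k) (q>0 k))
  where
  ↥↧≢0 : ∀ q → Positive q → NonZero (ℤ.∣ ↥ q ∣ ℕ.* ↧ₙ q)
  ↥↧≢0 (mkℚ +[1+ _ ] _ _) _ = _
... | p , p-prime , p∤↥↧ = p , p-prime , λ k →
  (λ p∣↥ → p∤↥↧ k (∣-trans p∣↥ (m∣m*n (↧ₙ q k)))) ,
  (λ p∣↧ → p∤↥↧ k (∣-trans p∣↧ (n∣m*n ℤ.∣ ↥ q k ∣)))

*-inv-cancelʳ : ∀ a {b} → b ≢ 0ℚ → a * b * inv b ≡ a
*-inv-cancelʳ a {b} b≢0 = begin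
  a * b * inv b      ≡⟨ *-assoc a b (inv b) ⟩
  a * (b * inv b)    ≡⟨ cong (a *_) (inv-inverseʳ b≢0) ⟩
  a * 1ℚ             ≡⟨ *-identityʳ a ⟩
  a                  ∎
  where open ≡-Reasoning

*-inv-*-cancelʳ : ∀ a b {x} → x ≢ 0ℚ → (a * x) * inv (b * x) ≡ a * inv b
*-inv-*-cancelʳ a b {x} x≢0 = begin
  (a * x) * inv (b * x)          ≡⟨ cong ((a * x) *_) (inv-* b x) ⟩
  (a * x) * (inv b * inv x)      ≡⟨ interchange a x (inv b) (inv x) ⟩
  (a * inv b) * (x * inv x)      ≡⟨ cong ((a * inv b) *_) (inv-inverseʳ x≢0) ⟩
  (a * inv b) * 1ℚ               ≡⟨ *-identityʳ _ ⟩
  a * inv b                      ∎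
  where open ≡-Reasoning

R-*-cancelʳ : ∀ d {a b} → b ≢ 0ℚ → R d (a * b) → R d b → R d a
R-*-cancelʳ d {a} b≢0 Rab Rb = subst (R d) (*-inv-cancelʳ a b≢0) (R-* d Rab (R-inv d Rb))

∣lcmF : ∀ l (n : Fin l → ℕ) i → n i ∣ lcmF l n
∣lcmF (suc l) n zero    = m∣lcm[m,n] (n zero) _
∣lcmF (suc l) n (suc i) = ∣-trans (∣lcmF l (λ i → n (suc i)) i) (n∣lcm[m,n] (n zero) _)

∣gcd*[N/b] : ∀ {a b N} .{{_ : NonZero b}} → a ∣ N → b ∣ N → a ∣ gcd a b ℕ.* (N / b)
∣gcd*[N/b] {a} {b} {N} a∣N b∣N with lcm-least a∣N b∣N
... | divides t N≡t*lcm = divides t (ℕ.*-cancelˡ-≡ _ _ b (begin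
  b ℕ.* (g ℕ.* (N / b))   ≡⟨ solve 3 (λ b g q → b :* (g :* q) := g :* (b :* q)) refl b g (N / b) ⟩
  g ℕ.* (b ℕ.* (N / b))   ≡⟨ cong (g ℕ.*_) (trans (m*[n/m]≡n b∣N) N≡t*lcm) ⟩
  g ℕ.* (t ℕ.* lcm a b)   ≡⟨ solve 3 (λ g t L → g :* (t :* L) := t :* (g :* L)) refl g t (lcm a b) ⟩
  t ℕ.* (g ℕ.* lcm a b)   ≡⟨ cong (t ℕ.*_) (gcd*lcm a b) ⟩
  t ℕ.* (a ℕ.* b)         ≡⟨ solve 3 (λ t a b → t :* (a :* b) := b :* (t :* a)) refl t a b ⟩
  b ℕ.* (t ℕ.* a)         ∎))
  where
  open ≡-Reasoning
  open +-*-Solver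
  g = gcd a b

module SolutionCoset (l : ℕ) (n : Fin l → ℕ) (n≢0 : ∀ i → NonZero (n i))
                     (u : Fin l → ℚ) (u>0 : ∀ i → Positive (u i)) (c : Fin l → ℤ)
                     (Σs≡1 : sumℤ l (λ i → c i ℤ.* + (_/_ (lcmF l n) (n i) {{n≢0 i}})) ≡ + 1) where

  N : ℕ
  N = lcmF l n

  e : Fin l → ℕ
  e i = _/_ N (n i) {{n≢0 i}}

  s : Fin l → ℤ
  s i = c i ℤ.* + e i

  x₀ : ℚ
  x₀ = prodℚ l (λ i → u i ^ℤ (- s i))

  x₀>0 : Positive x₀
  x₀>0 = prodℚ-pos l _ (λ i → ^ℤ-pos (u i) (- s i) (u>0 i))

  u≢0 : ∀ i → u i ≢ 0ℚ
  u≢0 i = pos⇒≢0 (u>0 i)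

  N∣n*e : ∀ i → N ∣ n i ℕ.* e i
  N∣n*e i = subst (N ∣_) (sym (m*[n/m]≡n {{n≢0 i}} (∣lcmF l n i))) ∣-refl

  ∏q^s≡q : ∀ {q} → q ≢ 0ℚ → prodℚ l (λ i → q ^ℤ s i) ≡ q
  ∏q^s≡q {q} q≢0 = trans (prodℚ-^ℤ q≢0 l s) (trans (cong (q ^ℤ_) Σs≡1) (*-identityʳ q))

  x₀≡∏[1/u]^s : x₀ ≡ prodℚ l (λ i → inv (u i) ^ℤ s i)
  x₀≡∏[1/u]^s = prodℚ-cong l (λ i → trans (^ℤ-neg (u i) (s i)) (sym (inv-^ℤ (u i) (s i))))

  x≡x₀*∏[ux]^s : ∀ {x} → x ≢ 0ℚ → x ≡ x₀ * prodℚ l (λ i → (u i * x) ^ℤ s i)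
  x≡x₀*∏[ux]^s {x} x≢0 = begin
    x                                                      ≡⟨ ∏q^s≡q x≢0 ⟨
    prodℚ l (λ i → x ^ℤ s i)                               ≡⟨ prodℚ-cong l split ⟩
    prodℚ l (λ i → inv (u i) ^ℤ s i * (u i * x) ^ℤ s i)    ≡⟨ prodℚ-distrib-* l _ _ ⟩
    prodℚ l (λ i → inv (u i) ^ℤ s i) * ∏[ux]^s             ≡⟨ cong (_* ∏[ux]^s) x₀≡∏[1/u]^s ⟨
    x₀ * ∏[ux]^s                                           ∎
    where
    open ≡-Reasoning
    ∏[ux]^s = prodℚ l (λ i → (u i * x) ^ℤ s i)
    split : ∀ i → x ^ℤ s i ≡ inv (u i) ^ℤ s i * (u i * x) ^ℤ s i
    split i = begin
      x ^ℤ s i                             ≡⟨ cong (_^ℤ s i) (*-identityˡ x) ⟨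
      (1ℚ * x) ^ℤ s i                      ≡⟨ cong (λ z → (z * x) ^ℤ s i) (inv-inverseˡ (u≢0 i)) ⟨
      (inv (u i) * u i * x) ^ℤ s i         ≡⟨ cong (_^ℤ s i) (*-assoc (inv (u i)) (u i) x) ⟩
      (inv (u i) * (u i * x)) ^ℤ s i       ≡⟨ ^ℤ-distribʳ-* (inv (u i)) (u i * x) (s i) ⟩
      inv (u i) ^ℤ s i * (u i * x) ^ℤ s i  ∎

  u*x₀≡∏[u/u]^s : ∀ j → u j * x₀ ≡ prodℚ l (λ i → (u j * inv (u i)) ^ℤ s i)
  u*x₀≡∏[u/u]^s j = begin
    u j * x₀
      ≡⟨ cong₂ _*_ (sym (∏q^s≡q (u≢0 j))) x₀≡∏[1/u]^s ⟩
    prodℚ l (λ i → u j ^ℤ s i) * prodℚ l (λ i → inv (u i) ^ℤ s i)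
      ≡⟨ prodℚ-distrib-* l _ _ ⟨
    prodℚ l (λ i → u j ^ℤ s i * inv (u i) ^ℤ s i)
      ≡⟨ prodℚ-cong l (λ i → ^ℤ-distribʳ-* (u j) (inv (u i)) (s i)) ⟨
    prodℚ l (λ i → (u j * inv (u i)) ^ℤ s i)
      ∎
    where open ≡-Reasoning

  R-^s : ∀ {d′} d {q} i → q ≢ 0ℚ → d′ ∣ d ℕ.* e i → R d q → R d′ (q ^ℤ s i)
  R-^s d {q} i q≢0 d′∣d*e Rq = R-∣ d′∣d*e
    (subst (R (d ℕ.* e i)) (^ℤ-*-assoc q≢0 (c i) (e i)) (R-^ℕ d (e i) (R-^ℤ d (c i) Rq)))

  module _ {x} (x>0 : Positive x) (Rux : ∀ j → R (n j) (u j * x)) where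

    private
      x≢0 : x ≢ 0ℚ
      x≢0 = pos⇒≢0 x>0

    R-gcd : ∀ i j → R (gcd (n i) (n j)) (u i * inv (u j))
    R-gcd i j = subst (R g) (*-inv-*-cancelʳ (u i) (u j) x≢0)
      (R-* g (R-∣ (gcd[m,n]∣m (n i) (n j)) (Rux i)) (R-inv g (R-∣ (gcd[m,n]∣n (n i) (n j)) (Rux j))))
      where g = gcd (n i) (n j)

    R[v*x₀]⇒R[v*x] : ∀ {d} v → d ∣ N → R d (v * x₀) → R d (v * x)
    R[v*x₀]⇒R[v*x] {d} v d∣N Rvx₀ =
      subst (R d) (trans (*-assoc v x₀ _) (cong (v *_) (sym (x≡x₀*∏[ux]^s x≢0))))
        (R-* d Rvx₀ (R-∣ d∣N (R-prodℚ N l _ R-factor)))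
      where
      R-factor : ∀ i → R N ((u i * x) ^ℤ s i)
      R-factor i = R-^s (n i) i (pos⇒≢0 (*-pos (u i) x (u>0 i) x>0)) (N∣n*e i) (Rux i)

  module _ (gcd-condition : ∀ i j → i ≢ j → R (gcd (n i) (n j)) (u i * inv (u j))) where

    R[u*x₀] : ∀ j → R (n j) (u j * x₀)
    R[u*x₀] j = subst (R (n j)) (sym (u*x₀≡∏[u/u]^s j)) (R-prodℚ (n j) l _ R-factor)
      where
      R-factor : ∀ i → R (n j) ((u j * inv (u i)) ^ℤ s i)
      R-factor i with i Fin.≟ j
      ... | yes refl = subst (λ q → R (n i) (q ^ℤ s i)) (sym (inv-inverseʳ (u≢0 i)))
                         (R-^ℤ (n i) (s i) (R-1 (n i)))
      ... | no  i≢j  = R-^s (gcd (n j) (n i)) i u/u≢0 (∣gcd*[N/b] {{n≢0 i}} (∣lcmF l n j) (∣lcmF l n i))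
                         (gcd-condition j i (λ j≡i → i≢j (sym j≡i)))
        where
        u/u≢0 : u j * inv (u i) ≢ 0ℚ
        u/u≢0 = pos⇒≢0 (*-pos (u j) (inv (u i)) (u>0 j) (inv-pos (u i) (u>0 i)))

    ∃solution : ∀ {ℓ} (m : Fin ℓ → ℕ) → (∀ k → NonZero (m k)) →
                (v : Fin ℓ → ℚ) → (∀ k → Positive (v k)) → (∀ k → m k ∣ N → ¬ R (m k) (v k * x₀)) →
                ∃ λ x → Positive x × (∀ j → R (n j) (u j * x)) × (∀ k → ¬ R (m k) (v k * x))
    ∃solution {ℓ} m m≢0 v v>0 ¬Rvx₀
      with ∃-prime-∤-↥↧ ℓ (λ k → v k * x₀) (λ k → *-pos (v k) x₀ (v>0 k) x₀>0)
    ... | p , p-prime , p∤↥↧ = x₀ * pᴺ , *-pos x₀ pᴺ x₀>0 pᴺ>0 , Rux , ¬Rvx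
      where
      pᴺ = fromℕ p ^ℕ N
      pᴺ>0 : Positive pᴺ
      pᴺ>0 = ^ℕ-pos (fromℕ p) N (fromℕ-pos p {{prime⇒nonZero p-prime}})
      R-pᴺ : ∀ {d} → d ∣ N → R d pᴺ
      R-pᴺ d∣N = R-∣ d∣N (fromℕ p , refl)
      reassoc : ∀ a → a * (x₀ * pᴺ) ≡ a * x₀ * pᴺ
      reassoc a = sym (*-assoc a x₀ pᴺ)
      Rux : ∀ j → R (n j) (u j * (x₀ * pᴺ))
      Rux j = subst (R (n j)) (sym (reassoc (u j))) (R-* (n j) (R[u*x₀] j) (R-pᴺ (∣lcmF l n j)))
      ¬Rvx : ∀ k → ¬ R (m k) (v k * (x₀ * pᴺ))
      ¬Rvx k Rvx with m k ∣? N | subst (R (m k)) (reassoc (v k)) Rvx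
      ... | yes m∣N | Rvx₀pᴺ = ¬Rvx₀ k m∣N (R-*-cancelʳ (m k) (pos⇒≢0 pᴺ>0) Rvx₀pᴺ (R-pᴺ m∣N))
      ... | no  m∤N | Rvx₀pᴺ =
        ¬R[q*p^N] p-prime (v k * x₀) (proj₁ (p∤↥↧ k)) (proj₂ (p∤↥↧ k)) (m k) N {{m≢0 k}} m∤N Rvx₀pᴺ

lemma3 : (l ℓ : ℕ) → 1 ≤ l →
    (n : Fin l → ℕ) (nz : ∀ i → NonZero (n i)) →
    (m : Fin ℓ → ℕ) → (∀ k → NonZero (m k)) →
    (u : Fin l → ℚ) → (∀ i → Positive (u i)) →
    (v : Fin ℓ → ℚ) → (∀ k → Positive (v k)) →
    (c : Fin l → ℤ) →
    sumℤ l (λ i → c i ℤ.* (+ (_/_ (lcmF l n) (n i) {{nz i}}))) ≡ + 1 →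
    (∃ (λ (x : ℚ) → Positive x × (∀ j → R (n j) (u j * x)) × (∀ k → ¬ R (m k) (v k * x))))
    ⇔
    ((∀ i j → i ≢ j → R (gcd (n i) (n j)) (u i * inv (u j)))
     × (∀ k → m k ∣ lcmF l n →
          ¬ R (m k) (v k * prodℚ l (λ i → u i ^ℤ (- (c i ℤ.* (+ (_/_ (lcmF l n) (n i) {{nz i}}))))))))
lemma3 l ℓ _ n n≢0 m m≢0 u u>0 v v>0 c Σs≡1 = mk⇔
  (λ (x , x>0 , Rux , ¬Rvx) →
    (λ i j _ → R-gcd x>0 Rux i j) ,
    (λ k m∣N Rvx₀ → ¬Rvx k (R[v*x₀]⇒R[v*x] x>0 Rux (v k) m∣N Rvx₀)))
  (λ (gcd-condition , ¬Rvx₀) → ∃solution gcd-condition m m≢0 v v>0 ¬Rvx₀)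
  where open SolutionCoset l n n≢0 u u>0 c Σs≡1
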